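{- Let $S$ be a set with a binary relation $R$ that is up-directed, reflexive and antisymmetric. Let $\approx$ be the equivalence on $\wp(S)$ with $X\approx Y$ iff $X^{l}=Y^{l}$ and $X^{u}=Y^{u}$; write $[X]_\approx$ for the class of $X$, and for a class $a$ let $a_l=X^{l}$, $a_u=X^{u}$ for any $X\in a$. On classes define $L(a)=[\bigcup\{F^{l}: F\in a\}]_\approx$, $U(a)=[\bigcup\{F^{u}: F\in a\}]_\approx$, $a\,\breve{\cup}\,b=[\bigcup\{F\cup H: F\in a,\ H\in b\}]_\approx$, $\neg a=[\bigcup\{S\setminus F: F\in a\}]_\approx$. Then for all classes $a,b$: (1) $a_u\subseteq (U a)_u$; (2) $a_l=(L a)_l\subseteq (U a)_l$; (3) $(a\,\breve{\cup}\,b)_u=a_u\cup b_u$; (4) $(\neg a)_u\subseteq (S\setminus a_l)^{u}$.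
   Context: $Rab$ means $(a,b)\in R$; up-directed means $(\forall a,b)(\exists c)\,Rac\,\&\,Rbc$. $[x]=\{y: Ryx\}$; for $A\subseteq S$, $A^{l}=\bigcup\{[x]: [x]\subseteq A\}$ and $A^{u}=\bigcup\{[x]: [x]\cap A\neq\emptyset\}$. -}

module Defs where

open import Level using (Level; _⊔_; 0ℓ) renaming (suc to lsuc)
open import Data.Product using (Σ; ∃; ∃-syntax; _×_; _,_)
open import Relation.Unary using (Pred; _⊆_; _∪_; ∁; _≐_)
open import Relation.Binary.PropositionalEquality using (_≡_)

module _ {S : Set} (R : S → S → Set) where

  cell : S → Pred S 0ℓ
  cell x y = R y x

  lower : ∀ {ℓ} → Pred S ℓ → Pred S ℓ
  lower A x = ∃[ z ] ((cell z ⊆ A) × cell z x)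

  upper : ∀ {ℓ} → Pred S ℓ → Pred S ℓ
  upper A x = ∃[ z ] ((∃[ y ] (cell z y × A y)) × cell z x)

  _≈_ : Pred S 0ℓ → Pred S 0ℓ → Set
  X ≈ Y = (lower X ≐ lower Y) × (upper X ≐ upper Y)

  -- representatives of the classes L[X], U[X], [X] ∪̆ [Y], ¬[X]
  Lrep : Pred S 0ℓ → Pred S (lsuc 0ℓ)
  Lrep X x = ∃[ F ] ((F ≈ X) × lower F x)

  Urep : Pred S 0ℓ → Pred S (lsuc 0ℓ)
  Urep X x = ∃[ F ] ((F ≈ X) × upper F x)

  Jrep : Pred S 0ℓ → Pred S 0ℓ → Pred S (lsuc 0ℓ)
  Jrep X Y x = ∃[ F ] ∃[ H ] ((F ≈ X) × (H ≈ Y) × (F ∪ H) x)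

  Nrep : Pred S 0ℓ → Pred S (lsuc 0ℓ)
  Nrep X x = ∃[ F ] ((F ≈ X) × ∁ F x)

  Reflexive : Set
  Reflexive = ∀ x → R x x

  Antisymmetric : Set
  Antisymmetric = ∀ x y → R x y → R y x → x ≡ y

  UpDirected : Set
  UpDirected = ∀ a b → ∃[ c ] (R a c × R b c)

module Submission where

-- Everything follows from elementary facts about the two approximation
-- operators  A^l = ⋃{[z] : [z] ⊆ A}  and  A^u = ⋃{[z] : [z] ∩ A ≠ ∅},
-- valid for an arbitrary relation R:  both are monotone, A^l ⊆ A,
-- A^l ⊆ A^u, A^l ⊆ (A^l)^l, A^u ⊆ (A^u)^u, (A ∪ B)^u = A^u ∪ B^u, and
-- A^u is the union of the upper approximations of the points of A
-- ('upper-lub').  A class operation is represented by the union over all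
-- members F of the class; since X belongs to its own class, each such union
-- contains the corresponding set built from X, while every member F shares
-- F^l = X^l and F^u = X^u.

open import Defs
open import Level using (Level; 0ℓ)
open import Data.Product using (_×_; _,_; proj₁; proj₂; Σ-syntax)
open import Data.Sum using (inj₁; inj₂; [_,_])
open import Function using (_∘′_)
open import Relation.Unary using (Pred; _⊆_; _∪_; ∁; _≐_)

module _ {S : Set} (R : S → S → Set) where

  private
    variable
      a b c : Level
      A : Pred S a
      B : Pred S b
      C : Pred S c

  ≈-refl : (X : Pred S 0ℓ) → _≈_ R X X
  ≈-refl X = ((λ p → p) , (λ p → p)) , ((λ p → p) , (λ p → p))

  lower-⊆ : lower R A ⊆ A
  lower-⊆ (z , [z]⊆A , x∈[z]) = [z]⊆A x∈[z]

  lower-mono : A ⊆ B → lower R A ⊆ lower R B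
  lower-mono A⊆B (z , [z]⊆A , x∈[z]) = z , (λ y∈[z] → A⊆B ([z]⊆A y∈[z])) , x∈[z]

  upper-mono : A ⊆ B → upper R A ⊆ upper R B
  upper-mono A⊆B (z , (y , y∈[z] , Ay) , x∈[z]) = z , (y , y∈[z] , A⊆B Ay) , x∈[z]

  -- A^l ⊆ A^u: a cell contained in A meets A at the point under consideration.
  lower⊆upper : lower R A ⊆ upper R A
  lower⊆upper (z , [z]⊆A , x∈[z]) = z , (_ , x∈[z] , [z]⊆A x∈[z]) , x∈[z]

  -- A^l ⊆ (A^l)^l: a cell inside A lies entirely in A^l.
  lower-idem : lower R A ⊆ lower R (lower R A)
  lower-idem (z , [z]⊆A , x∈[z]) = z , (λ y∈[z] → z , [z]⊆A , y∈[z]) , x∈[z]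

  -- A^u ⊆ (A^u)^u: the witness point of A in a cell lies in A^u.
  upper-idem : upper R A ⊆ upper R (upper R A)
  upper-idem (z , (y , y∈[z] , Ay) , x∈[z]) =
    z , (y , y∈[z] , (z , (y , y∈[z] , Ay) , y∈[z])) , x∈[z]

  upper-lub : (∀ {y} → A y → Σ[ B ∈ Pred S b ] (B y × upper R B ⊆ C)) →
              upper R A ⊆ C
  upper-lub local (z , (y , y∈[z] , Ay) , x∈[z]) with local Ay
  ... | B , By , B^u⊆C = B^u⊆C (z , (y , y∈[z] , By) , x∈[z])

  upper-∪ : upper R (A ∪ B) ≐ (upper R A ∪ upper R B)
  upper-∪ = to , [ upper-mono inj₁ , upper-mono inj₂ ]
    where
    to : upper R (A ∪ B) ⊆ (upper R A ∪ upper R B)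
    to (z , (y , y∈[z] , inj₁ Ay) , x∈[z]) = inj₁ (z , (y , y∈[z] , Ay) , x∈[z])
    to (z , (y , y∈[z] , inj₂ By) , x∈[z]) = inj₂ (z , (y , y∈[z] , By) , x∈[z])

  module _ (X : Pred S 0ℓ) where

    -- (1)  a_u ⊆ (U a)_u,  since X^u is one of the sets whose union is U a.
    upper-⊆-U : upper R X ⊆ upper R (Urep R X)
    upper-⊆-U = upper-mono (λ x∈X^u → X , ≈-refl X , x∈X^u) ∘′ upper-idem

    -- Every member F of the class of X has F^l = X^l, so L a lies in X^l.
    Lrep-⊆-lower : Lrep R X ⊆ lower R X
    Lrep-⊆-lower (F , (F^l≐X^l , _) , x∈F^l) = proj₁ F^l≐X^l x∈F^l

    lower-≐-L : lower R X ≐ lower R (Lrep R X)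
    lower-≐-L = (λ x∈X^l → lower-mono (λ p → X , ≈-refl X , p) (lower-idem x∈X^l))
              , (λ x∈La^l → lower-⊆ (lower-mono Lrep-⊆-lower x∈La^l))

    -- (2b)  (L a)_l ⊆ (U a)_l,  since F^l ⊆ F^u for every member F.
    L-⊆-U : lower R (Lrep R X) ⊆ lower R (Urep R X)
    L-⊆-U = lower-mono (λ (F , F≈X , x∈F^l) → F , F≈X , lower⊆upper x∈F^l)

    upper-J : (Y : Pred S 0ℓ) → upper R (Jrep R X Y) ≐ (upper R X ∪ upper R Y)
    upper-J Y = upper-lub member , (upper-mono members ∘′ proj₂ upper-∪)
      where
      -- each point of a ∪̆ b lies in some F ∪ H with F^u = X^u, H^u = Y^u
      member : ∀ {y} → Jrep R X Y y →
               Σ[ B ∈ Pred S 0ℓ ] (B y × upper R B ⊆ (upper R X ∪ upper R Y))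
      member (F , H , (_ , F^u≐X^u) , (_ , H^u≐Y^u) , y∈F∪H) =
        F ∪ H , y∈F∪H ,
        λ x → [ inj₁ ∘′ proj₁ F^u≐X^u , inj₂ ∘′ proj₁ H^u≐Y^u ] (proj₁ upper-∪ x)
      -- X ∪ Y itself is one of the sets whose union is a ∪̆ b
      members : (X ∪ Y) ⊆ Jrep R X Y
      members x = X , Y , ≈-refl X , ≈-refl Y , x

    -- (4)  (¬ a)_u ⊆ (S ∖ a_l)^u,  since S ∖ F ⊆ S ∖ F^l = S ∖ X^l for members F.
    upper-N : upper R (Nrep R X) ⊆ upper R (∁ (lower R X))
    upper-N = upper-lub λ (F , (F^l≐X^l , _) , y∉F) →
      ∁ F , y∉F , upper-mono (λ x∉F x∈X^l → x∉F (lower-⊆ (proj₂ F^l≐X^l x∈X^l)))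

mainTheorem7 : (S : Set) (R : S → S → Set) →
    UpDirected R → Reflexive R → Antisymmetric R →
    (X Y : Pred S 0ℓ) →
    (upper R X ⊆ upper R (Urep R X))
    × ((lower R X ≐ lower R (Lrep R X)) × (lower R (Lrep R X) ⊆ lower R (Urep R X)))
    × (upper R (Jrep R X Y) ≐ (upper R X ∪ upper R Y))
    × (upper R (Nrep R X) ⊆ upper R (∁ (lower R X)))
mainTheorem7 S R _ _ _ X Y =
    upper-⊆-U R X
  , (lower-≐-L R X , L-⊆-U R X)
  , upper-J R X Y
  , upper-N R X
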